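{- Let $G$ be a connected BDH graph with color classes $X$ and $Y$. Then there exist an arborescence $A$ and a bijection $\phi$ from $X$ to the arc set of $A$ such that for every $y\in Y$, the set $\{\phi x\mid x\in N(y)\}$ is the arc set of a directed path in $A$.
   Context: A BDH graph is a bipartite distance hereditary graph, i.e. a bipartite graph $G$ such that for every connected induced subgraph $H$ and all $u,w\in V(H)$, $d_H(u,w)=d_G(u,w)$. An arborescence is a directed tree with a root such that every other node is reachable from the root by a directed path. $N(y)$ is the neighborhood of $y$. -}

module Defs where

open import Data.Nat using (ℕ; zero; suc; _≤_)
open import Data.Fin using (Fin)
open import Data.Bool using (Bool; true; false)
open import Data.Sum using (_⊎_; inj₁; inj₂)
open import Data.Product using (Σ; ∃; _×_; _,_)
open import Data.Empty using (⊥)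
open import Data.Unit using (⊤)
open import Data.List using (List; []; _∷_)
open import Data.List.Membership.Propositional using (_∈_)
open import Data.List.Relation.Unary.Unique.Propositional using (Unique)
open import Relation.Binary.PropositionalEquality using (_≡_)
open import Function.Bundles using (_⇔_; _⤖_)

-- Finite bipartite graphs with fixed colour classes X = Fin m, Y = Fin n.
-- E x y ≡ true  iff  x ∈ X and y ∈ Y are adjacent.

record BipGraph : Set where
  field
    m n : ℕ
    E   : Fin m → Fin n → Bool

module _ (G : BipGraph) where
  open BipGraph G

  Vertex : Set
  Vertex = Fin m ⊎ Fin n

  Adj : Vertex → Vertex → Set
  Adj (inj₁ x) (inj₂ y) = E x y ≡ true
  Adj (inj₂ y) (inj₁ x) = E x y ≡ true
  Adj (inj₁ _) (inj₁ _) = ⊥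
  Adj (inj₂ _) (inj₂ _) = ⊥

  -- a vertex subset (vertex set of an induced subgraph)
  VSet : Set
  VSet = Vertex → Bool

  allV : VSet
  allV _ = true

  data Walk (S : VSet) : Vertex → Vertex → ℕ → Set where
    here : ∀ {u} → S u ≡ true → Walk S u u zero
    step : ∀ {u v w k} → S u ≡ true → Adj u v → Walk S v w k →
           Walk S u w (suc k)

  DistLe : VSet → Vertex → Vertex → ℕ → Set
  DistLe S u w k = ∃ λ k' → k' ≤ k × Walk S u w k'

  ConnectedOn : VSet → Set
  ConnectedOn S = ∀ u w → S u ≡ true → S w ≡ true → ∃ λ k → Walk S u w k

  -- d_H(u,w) = d_G(u,w), expressed as: for all k, d_G(u,w) ≤ k ⇔ d_H(u,w) ≤ k
  DistEq : VSet → Vertex → Vertex → Set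
  DistEq S u w = ∀ k → DistLe allV u w k ⇔ DistLe S u w k

Connected : BipGraph → Set
Connected G = ConnectedOn G (allV G)

IsBDH : BipGraph → Set
IsBDH G = ∀ (S : VSet G) → ConnectedOn G S →
          ∀ u w → S u ≡ true → S w ≡ true → DistEq G S u w

_∈N_ : {G : BipGraph} → Fin (BipGraph.m G) → Fin (BipGraph.n G) → Set
_∈N_ {G} x y = BipGraph.E G x y ≡ true

record Digraph : Set where
  field
    p q  : ℕ
    tail : Fin q → Fin p
    head : Fin q → Fin p

module _ (D : Digraph) where
  open Digraph D

  Node Arc : Set
  Node = Fin p
  Arc  = Fin q

  data UWalk : Node → Node → List Arc → Set where
    nil  : ∀ {u} → UWalk u u []
    fwd  : ∀ {w as} (a : Arc) → UWalk (head a) w as → UWalk (tail a) w (a ∷ as)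
    bwd  : ∀ {w as} (a : Arc) → UWalk (tail a) w as → UWalk (head a) w (a ∷ as)

  data DWalk : Node → Node → List Arc → Set where
    nil  : ∀ {u} → DWalk u u []
    cons : ∀ {w as} (a : Arc) → DWalk (head a) w as → DWalk (tail a) w (a ∷ as)

  nodesOf : ∀ {u w as} → DWalk u w as → List Node
  nodesOf (nil {u}) = u ∷ []
  nodesOf (cons a r) = tail a ∷ nodesOf r

  DPath : Node → Node → List Arc → Set
  DPath u w as = Σ (DWalk u w as) λ P → Unique (nodesOf P)

  UConnected : Set
  UConnected = ∀ u w → ∃ λ as → UWalk u w as

  UAcyclic : Set
  UAcyclic = ∀ u a as → UWalk u u (a ∷ as) → Unique (a ∷ as) → ⊥

  IsDirectedTree : Set
  IsDirectedTree = UConnected × UAcyclic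

  IsArborescence : Set
  IsArborescence = IsDirectedTree ×
                   (∃ λ (r : Node) → ∀ v → ∃ λ as → DPath r v as)

ArcSetIs : (G : BipGraph) (D : Digraph) →
           (Fin (BipGraph.m G) → Fin (Digraph.q D)) →
           Fin (BipGraph.n G) → List (Fin (Digraph.q D)) → Set
ArcSetIs G D φ y as =
  ∀ a → (a ∈ as) ⇔ (∃ λ x → (_∈N_ {G} x y) × φ x ≡ a)

module Submission where

-- For a connected BDH graph G with colour classes X and Y we build a rooted
-- tree whose arcs are the vertices of X (so φ is the identity) such that
-- every neighbourhood N(y) is a parent chain, i.e. the arc set of a directed
-- path.  The tree comes from a parent function on X whose parents have
-- smaller rank (ParentTree): arc x starts where the arc of its parent ends.
-- A "chain representation" of a connected vertex subset S (such a parent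
-- function plus a chain for every y ∈ S) is built by induction on |S|
-- (Construction).  By distance heredity, analysed with breadth-first
-- distances, every connected S with two vertices has a pendant vertex or a
-- pair of twins (BDH); deleting it keeps S connected, and the vertex is put
-- back by hand (Representation): a pendant x becomes a child of the end of
-- its neighbour's chain, a twin x becomes the new parent of its twin, and a
-- vertex of Y only needs one chain.

open import Defs
open import Data.Nat using (ℕ; zero; suc; _+_; _≤_; _<_; _≤?_; _<?_; z≤n; s≤s; s≤s⁻¹)
open import Data.Nat.Properties
open import Data.Fin using (Fin; zero; suc)
import Data.Fin.Properties as Fin
open import Data.Maybe using (Maybe; just; nothing)
open import Data.Maybe.Properties using (just-injective)
open import Data.Bool using (Bool; true; false; not; _xor_)
open import Data.Bool.Properties using (not-involutive) renaming (_≟_ to _≟ᵇ_)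
open import Data.Product using (Σ; ∃; _×_; _,_; proj₁; proj₂)
open import Data.Sum using (_⊎_; inj₁; inj₂; map₁)
import Data.Sum.Properties as Sum
open import Data.Empty using (⊥; ⊥-elim)
open import Data.List using (List; []; _∷_; _++_; map; allFin; upTo; filter; last)
open import Data.List.Relation.Unary.Any using (here; there)
open import Data.List.Relation.Unary.All as All using (All; []; _∷_)
import Data.List.Relation.Unary.AllPairs as AllPairs
open import Data.List.Relation.Unary.Unique.Propositional using (Unique)
open import Data.List.Membership.Propositional using (_∈_; _∉_)
open import Data.List.Membership.Propositional.Properties
  using (∈-allFin; ∈-map⁺; ∈-++⁺ˡ; ∈-++⁺ʳ; ∈-++⁻; ∈-filter⁺; ∈-upTo⁺)
open import Data.List.Relation.Unary.All.Properties using (all-filter)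
open import Data.List.Extrema ≤-totalOrder
  using (argmin; argmin-all; f[argmin]≤f[⊤]; f[argmin]≤f[xs]; argmax; argmax-all; f[xs]≤f[argmax])
open import Relation.Binary.PropositionalEquality
open import Relation.Binary using (DecidableEquality; tri<; tri≈; tri>)
open import Relation.Nullary using (Dec; yes; no; ¬_; does)
open import Relation.Nullary.Decidable using (_×-dec_; _⊎-dec_; ¬?; dec-true; dec-false)
open import Function.Bundles using (_⤖_; Bijection; mk⇔; Equivalence)
open import Function.Construct.Identity using (⤖-id)
open import Function.Base using (_∘_; const)
open import Data.Vec.Functional using (updateAt)
open import Data.Vec.Functional.Properties using (updateAt-updates; updateAt-minimal)

fresh : ∀ {A : Set} {b : A} {bs} → Unique (b ∷ bs) → b ∉ bs
fresh uq b∈ = All.lookup (AllPairs.head uq) b∈ refl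

data ParentChain {m : ℕ} (par : Fin m → Maybe (Fin m)) : List (Fin m) → Set where
  empty  : ParentChain par []
  single : ∀ x → ParentChain par (x ∷ [])
  link   : ∀ {x y ys} → par y ≡ just x → ParentChain par (y ∷ ys) →
           ParentChain par (x ∷ y ∷ ys)

last-∈ : ∀ {A : Set} (xs : List A) {x} → last xs ≡ just x → x ∈ xs
last-∈ (y ∷ [])         refl = here refl
last-∈ (y ∷ xs@(_ ∷ _)) e    = there (last-∈ xs e)

module _ {m : ℕ} where

  rechain : ∀ {par par' : Fin m → Maybe (Fin m)} {c cs} → ParentChain par (c ∷ cs) →
            (∀ j → j ∈ cs → par' j ≡ par j) → ParentChain par' (c ∷ cs)
  rechain (single c)          agree = single c
  rechain (link {y = j} e ch) agree = link (trans (agree j (here refl)) e) (rechain ch (λ k → agree k ∘ there))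

  rechain-all : ∀ {par par' : Fin m → Maybe (Fin m)} {cs} → ParentChain par cs →
                (∀ j → j ∈ cs → par' j ≡ par j) → ParentChain par' cs
  rechain-all {cs = []}    empty _     = empty
  rechain-all {cs = _ ∷ _} ch    agree = rechain ch (λ k → agree k ∘ there)

  chain-snoc : ∀ {par : Fin m → Maybe (Fin m)} {cs} → ParentChain par cs →
               ∀ x → par x ≡ last cs → ParentChain par (cs ++ x ∷ [])
  chain-snoc empty        x e = single x
  chain-snoc (single c)   x e = link e (single x)
  chain-snoc (link e' ch) x e = link e' (chain-snoc ch x e)

  chain-rank : ∀ {par : Fin m → Maybe (Fin m)} (rank : Fin m → ℕ) →
               (∀ x p → par x ≡ just p → rank p < rank x) →
               ∀ {c cs} → ParentChain par (c ∷ cs) → ∀ j → j ∈ cs → rank c < rank j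
  chain-rank rank rank-par (link {y = j} e ch) .j (here refl) = rank-par j _ e
  chain-rank rank rank-par (link {y = j} e ch) k  (there k∈)  =
    <-trans (rank-par j _ e) (chain-rank rank rank-par ch k k∈)

-- Node 0 is the root, node (suc x) is the head of arc x, and arc x
-- starts where its parent arc ends (at the root if x has no parent).
module ParentTree {m : ℕ} (par : Fin m → Maybe (Fin m)) (rank : Fin m → ℕ)
                  (rank-par : ∀ x p → par x ≡ just p → rank p < rank x) where

  node : Maybe (Fin m) → Fin (suc m)
  node nothing  = zero
  node (just p) = suc p

  tree : Digraph
  tree = record { p = suc m ; q = m ; tail = λ x → node (par x) ; head = suc }

  open Digraph tree using (tail; head)

  height : Fin (suc m) → ℕ
  height zero    = 0
  height (suc x) = suc (rank x)

  tail<head : ∀ a → height (tail a) < height (head a)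
  tail<head a with par a in eq
  ... | nothing = s≤s z≤n
  ... | just p  = s≤s (rank-par a p eq)

  -- Every node of a directed walk is at least as high as its start; hence
  -- directed walks never repeat a node, i.e. they are directed paths.
  heights-above : ∀ {u w as} (P : DWalk tree u w as) →
                  All (λ v → height u ≤ height v) (nodesOf tree P)
  heights-above nil        = ≤-refl ∷ []
  heights-above (cons a P) = ≤-refl ∷ All.map (≤-trans (<⇒≤ (tail<head a))) (heights-above P)

  dwalk-unique : ∀ {u w as} (P : DWalk tree u w as) → Unique (nodesOf tree P)
  dwalk-unique nil        = [] AllPairs.∷ AllPairs.[]
  dwalk-unique (cons a P) =
    All.map (λ above eq → <⇒≱ (tail<head a) (subst (λ v → height (head a) ≤ height v) (sym eq) above))
            (heights-above P)
    AllPairs.∷ dwalk-unique P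

  dpath : ∀ {u w as} → DWalk tree u w as → DPath tree u w as
  dpath P = P , dwalk-unique P

  dwalk-snoc : ∀ {u w as} → DWalk tree u w as → ∀ a → tail a ≡ w →
               DWalk tree u (head a) (as ++ a ∷ [])
  dwalk-snoc nil        a refl = cons a nil
  dwalk-snoc (cons b P) a eq   = cons b (dwalk-snoc P a eq)

  -- Following parents (which terminates since ranks decrease) gives a
  -- directed walk from the root to every node.
  from-root : ∀ v → ∃ λ as → DWalk tree zero v as
  from-root zero    = [] , nil
  from-root (suc x) = ancestors (suc (rank x)) x ≤-refl
    where
    ancestors : ∀ fuel x → rank x < fuel → ∃ λ as → DWalk tree zero (suc x) as
    ancestors (suc fuel) x lt with par x in eq
    ... | nothing = _ , dwalk-snoc nil x (cong node eq)
    ... | just p  = _ , dwalk-snoc (proj₂ (ancestors fuel p (<-≤-trans (rank-par x p eq) (s≤s⁻¹ lt))))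
                                   x (cong node eq)

  undirected : ∀ {u w as} → DWalk tree u w as → UWalk tree u w as
  undirected nil        = nil
  undirected (cons a P) = fwd a (undirected P)

  uwalk-++ : ∀ {u v w as bs} → UWalk tree u v as → UWalk tree v w bs → UWalk tree u w (as ++ bs)
  uwalk-++ nil       Q = Q
  uwalk-++ (fwd a P) Q = fwd a (uwalk-++ P Q)
  uwalk-++ (bwd a P) Q = bwd a (uwalk-++ P Q)

  uwalk-reverse : ∀ {u w as} → UWalk tree u w as → ∃ λ bs → UWalk tree w u bs
  uwalk-reverse nil       = [] , nil
  uwalk-reverse (fwd a P) = _ , uwalk-++ (proj₂ (uwalk-reverse P)) (bwd a nil)
  uwalk-reverse (bwd a P) = _ , uwalk-++ (proj₂ (uwalk-reverse P)) (fwd a nil)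

  connected : UConnected tree
  connected u w = _ , uwalk-++ (proj₂ (uwalk-reverse (undirected (proj₂ (from-root u)))))
                               (undirected (proj₂ (from-root w)))

  -- The only arc entering node (suc a) is a, so a trail that
  -- leaves (suc a) without reusing a can only climb ("climbs"), and a trail
  -- that reaches (suc a) without using a has descended ("descends").  A cycle
  -- through arc a contradicts one of the two.
  climbs : ∀ {u w as} → UWalk tree u w as → ∀ a → u ≡ head a → a ∉ as → Unique as →
           height u ≤ height w
  climbs nil       a e a∉ uq = ≤-refl
  climbs (fwd b P) a e a∉ uq = ≤-trans (<⇒≤ (tail<head b)) (climbs P b refl (fresh uq) (AllPairs.tail uq))
  climbs (bwd b P) a e a∉ uq = ⊥-elim (a∉ (here (sym (Fin.suc-injective e))))

  climbs-strictly : ∀ {u w c cs} → UWalk tree u w (c ∷ cs) → ∀ a → u ≡ head a →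
                    a ∉ c ∷ cs → Unique (c ∷ cs) → height u < height w
  climbs-strictly (fwd c P) a e a∉ uq = <-≤-trans (tail<head c) (climbs P c refl (fresh uq) (AllPairs.tail uq))
  climbs-strictly (bwd c P) a e a∉ uq = ⊥-elim (a∉ (here (sym (Fin.suc-injective e))))

  trivial-walk : ∀ {u w} → UWalk tree u w [] → u ≡ w
  trivial-walk nil = refl

  descends : ∀ {u w as} → UWalk tree u w as → Unique as → ∀ a → w ≡ head a → a ∉ as →
             height w ≤ height u
  descends nil uq a e a∉ = ≤-refl
  descends (fwd {as = []} b P) uq a e a∉ =
    ⊥-elim (a∉ (here (sym (Fin.suc-injective (trans (trivial-walk P) e)))))
  descends (fwd {as = _ ∷ _} b P) uq a e a∉ =
    ⊥-elim (<⇒≱ (climbs-strictly P b refl (fresh uq) (AllPairs.tail uq)) (descends P (AllPairs.tail uq) a e (a∉ ∘ there)))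
  descends (bwd b P) uq a e a∉ = ≤-trans (descends P (AllPairs.tail uq) a e (a∉ ∘ there)) (<⇒≤ (tail<head b))

  acyclic : UAcyclic tree
  acyclic u a as (fwd a P) uq =
    <⇒≱ (tail<head a) (climbs P a refl (fresh uq) (AllPairs.tail uq))
  acyclic u a as (bwd a P) uq =
    <⇒≱ (tail<head a) (descends P (AllPairs.tail uq) a refl (fresh uq))

  isArborescence : IsArborescence tree
  isArborescence = (connected , acyclic) , zero ,
                   λ v → proj₁ (from-root v) , dpath (proj₂ (from-root v))

  chain-walk : ∀ {x xs} → ParentChain par (x ∷ xs) → ∃ λ w → DWalk tree (tail x) w (x ∷ xs)
  chain-walk (single x) = head x , cons x nil
  chain-walk (link {x} e ch) with chain-walk ch
  ... | w , P = w , cons x (subst (λ v → DWalk tree v w _) (cong node e) P)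

-- Extremal elements are only used through their stated properties, so the
-- searches are kept opaque (this also keeps type checking fast).
opaque
  minimiser : {A : Set} {P : A → Set} → (∀ a → Dec (P a)) → (f : A → ℕ) → (xs : List A) →
              ∀ v → P v → Σ A λ u → P u × f u ≤ f v × (∀ w → w ∈ xs → P w → f u ≤ f w)
  minimiser P? f xs v pv =
    argmin f v (filter P? xs) ,
    argmin-all f pv (all-filter P? xs) ,
    f[argmin]≤f[⊤] {f = f} v (filter P? xs) ,
    λ w w∈ pw → All.lookup (f[argmin]≤f[xs] {f = f} v (filter P? xs)) (∈-filter⁺ P? w∈ pw)

  maximiser : {A : Set} {P : A → Set} → (∀ a → Dec (P a)) → (f : A → ℕ) → (xs : List A) →
              ∀ v → P v → Σ A λ u → P u × (∀ w → w ∈ xs → P w → f w ≤ f u)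
  maximiser P? f xs v pv =
    argmax f v (filter P? xs) ,
    argmax-all f pv (all-filter P? xs) ,
    λ w w∈ pw → All.lookup (f[xs]≤f[argmax] {f = f} v (filter P? xs)) (∈-filter⁺ P? w∈ pw)

  least-witness : {P : ℕ → Set} → (∀ k → Dec (P k)) → ∀ {K} → P K →
                  Σ ℕ λ k → P k × (∀ j → P j → k ≤ j)
  least-witness {P} P? {K} pK with minimiser P? (λ k → k) (upTo K) K pK
  ... | k , pk , k≤K , below = k , pk , minimal
    where
    minimal : ∀ j → P j → k ≤ j
    minimal j pj with j <? K
    ... | yes j<K = below j (∈-upTo⁺ j<K) pj
    ... | no  j≮K = ≤-trans k≤K (≮⇒≥ j≮K)

true≢false : true ≢ false
true≢false ()

count : {A : Set} → (A → Bool) → List A → ℕ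
count P []       = 0
count P (x ∷ xs) with P x
... | true  = suc (count P xs)
... | false = count P xs

count-mono : {A : Set} (P Q : A → Bool) → (∀ x → P x ≡ true → Q x ≡ true) →
             ∀ xs → count P xs ≤ count Q xs
count-mono P Q P⊆Q []       = z≤n
count-mono P Q P⊆Q (x ∷ xs) with P x in px | Q x in qx
... | true  | true  = s≤s (count-mono P Q P⊆Q xs)
... | true  | false = ⊥-elim (true≢false (trans (sym (P⊆Q x px)) qx))
... | false | true  = m≤n⇒m≤1+n (count-mono P Q P⊆Q xs)
... | false | false = count-mono P Q P⊆Q xs

count-strict : {A : Set} (P Q : A → Bool) → (∀ x → P x ≡ true → Q x ≡ true) →
               ∀ {xs x₀} → x₀ ∈ xs → Q x₀ ≡ true → P x₀ ≡ false → count P xs < count Q xs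
count-strict P Q P⊆Q {x ∷ xs} (here refl) qx px rewrite px | qx = s≤s (count-mono P Q P⊆Q xs)
count-strict P Q P⊆Q {x ∷ xs} (there x₀∈) qx₀ px₀ with P x in px | Q x in qx
... | true  | true  = s≤s (count-strict P Q P⊆Q x₀∈ qx₀ px₀)
... | true  | false = ⊥-elim (true≢false (trans (sym (P⊆Q x px)) qx))
... | false | true  = m≤n⇒m≤1+n (count-strict P Q P⊆Q x₀∈ qx₀ px₀)
... | false | false = count-strict P Q P⊆Q x₀∈ qx₀ px₀

module Basics (G : BipGraph) where
  open BipGraph G public

  V : Set
  V = Vertex G

  _∈ˢ_ : V → VSet G → Set
  v ∈ˢ S = S v ≡ true

  _∈ˢ?_ : ∀ v S → Dec (v ∈ˢ S)
  v ∈ˢ? S = S v ≟ᵇ true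

  _≟V_ : DecidableEquality V
  _≟V_ = Sum.≡-dec Fin._≟_ Fin._≟_

  anyV : {P : V → Set} → (∀ v → Dec (P v)) → Dec (Σ V P)
  anyV P? with Fin.any? (P? ∘ inj₁) | Fin.any? (P? ∘ inj₂)
  ... | yes (x , px) | _            = yes (inj₁ x , px)
  ... | no _         | yes (y , py) = yes (inj₂ y , py)
  ... | no ¬X        | no ¬Y        = no λ { (inj₁ x , px) → ¬X (x , px) ; (inj₂ y , py) → ¬Y (y , py) }

  allVs : List V
  allVs = map inj₁ (allFin m) ++ map inj₂ (allFin n)

  ∈-allVs : ∀ v → v ∈ allVs
  ∈-allVs (inj₁ x) = ∈-++⁺ˡ (∈-map⁺ inj₁ (∈-allFin x))
  ∈-allVs (inj₂ y) = ∈-++⁺ʳ _ (∈-map⁺ inj₂ (∈-allFin y))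

  size : VSet G → ℕ
  size S = count S allVs

  ⟦_⟧ : {P : V → Set} → (∀ v → Dec (P v)) → VSet G
  ⟦ P? ⟧ v = does (P? v)

  ⟦⟧-intro : {P : V → Set} (P? : ∀ v → Dec (P v)) → ∀ {v} → P v → v ∈ˢ ⟦ P? ⟧
  ⟦⟧-intro P? {v} = dec-true (P? v)

  ⟦⟧-elim : {P : V → Set} (P? : ∀ v → Dec (P v)) → ∀ {v} → v ∈ˢ ⟦ P? ⟧ → P v
  ⟦⟧-elim P? {v} with P? v
  ... | yes pv = λ _ → pv
  ... | no  _  = λ ()

  ⟦⟧-out : {P : V → Set} (P? : ∀ v → Dec (P v)) → ∀ {v} → ¬ P v → ⟦ P? ⟧ v ≡ false
  ⟦⟧-out P? {v} = dec-false (P? v)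

  adj? : ∀ u w → Dec (Adj G u w)
  adj? (inj₁ x) (inj₂ y) = E x y ≟ᵇ true
  adj? (inj₂ y) (inj₁ x) = E x y ≟ᵇ true
  adj? (inj₁ _) (inj₁ _) = no λ ()
  adj? (inj₂ _) (inj₂ _) = no λ ()

  adj-sym : ∀ {u w} → Adj G u w → Adj G w u
  adj-sym {inj₁ x} {inj₂ y} a = a
  adj-sym {inj₂ y} {inj₁ x} a = a

  side : V → Bool
  side (inj₁ _) = true
  side (inj₂ _) = false

  adj-flips-side : ∀ {u w} → Adj G u w → side w ≡ not (side u)
  adj-flips-side {inj₁ x} {inj₂ y} a = refl
  adj-flips-side {inj₂ y} {inj₁ x} a = refl

  adj-sides : ∀ {u w} → Adj G u w → side u ≢ side w
  adj-sides {inj₁ x} {inj₂ y} a ()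
  adj-sides {inj₂ y} {inj₁ x} a ()

  adj-irrefl : ∀ {u} → ¬ Adj G u u
  adj-irrefl a = adj-sides a refl

  walk-start : ∀ {S u w k} → Walk G S u w k → u ∈ˢ S
  walk-start (here s)     = s
  walk-start (step s _ _) = s

  walk-zero : ∀ {S u w} → Walk G S u w 0 → u ≡ w
  walk-zero (here _) = refl

  walk-mono : ∀ {S T u w k} → (∀ x → x ∈ˢ S → x ∈ˢ T) → Walk G S u w k → Walk G T u w k
  walk-mono S⊆T (here s)     = here (S⊆T _ s)
  walk-mono S⊆T (step s a r) = step (S⊆T _ s) a (walk-mono S⊆T r)

  walk-in-G : ∀ {S u w k} → Walk G S u w k → Walk G (allV G) u w k
  walk-in-G = walk-mono (λ _ _ → refl)

  _++ʷ_ : ∀ {S u v w k l} → Walk G S u v k → Walk G S v w l → Walk G S u w (k + l)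
  here _     ++ʷ q = q
  step s a r ++ʷ q = step s a (r ++ʷ q)

  walk-reverse : ∀ {S u w k} → Walk G S u w k → Walk G S w u k
  walk-reverse (here s) = here s
  walk-reverse {k = suc k} (step s a r) =
    subst (Walk G _ _ _) (+-comm k 1) (walk-reverse r ++ʷ step (walk-start r) (adj-sym a) (here s))

  connected-via : ∀ S v → (∀ x → x ∈ˢ S → ∃ λ k → Walk G S x v k) → ConnectedOn G S
  connected-via S v reach x y sx sy = _ , proj₂ (reach x sx) ++ʷ walk-reverse (proj₂ (reach y sy))

  walk? : ∀ S k u w → Dec (Walk G S u w k)
  walk? S zero u w with u ≟V w | u ∈ˢ? S
  ... | yes refl | yes s = yes (here s)
  ... | yes refl | no ¬s = no λ p → ¬s (walk-start p)
  ... | no  u≢w  | _     = no λ p → u≢w (walk-zero p)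
  walk? S (suc k) u w with u ∈ˢ? S | anyV (λ x → adj? u x ×-dec walk? S k x w)
  ... | yes s | yes (x , a , r) = yes (step s a r)
  ... | yes s | no ¬step        = no λ { (step _ a r) → ¬step (_ , a , r) }
  ... | no ¬s | _               = no λ p → ¬s (walk-start p)

  parity : ℕ → Bool
  parity zero    = false
  parity (suc k) = not (parity k)

  walk-parity : ∀ {S u w k} → Walk G S u w k → side u ≡ side w xor parity k
  walk-parity {w = w} (here _) with side w
  ... | true  = refl
  ... | false = refl
  walk-parity {u = u} {w = w} {k = suc k} (step _ a r) = begin
    side u                        ≡⟨ not-involutive (side u) ⟨
    not (not (side u))            ≡⟨ cong not (adj-flips-side a) ⟨
    not (side _)                  ≡⟨ cong not (walk-parity r) ⟩
    not (side w xor parity k)     ≡⟨ not-xor (side w) (parity k) ⟩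
    side w xor not (parity k)     ∎
    where
    open ≡-Reasoning
    not-xor : ∀ a b → not (a xor b) ≡ a xor not b
    not-xor true  b = refl
    not-xor false b = refl

  potential-bound : ∀ {T : VSet G} (f : V → ℕ) →
                    (∀ s t → s ∈ˢ T → t ∈ˢ T → Adj G s t → f s ≤ suc (f t)) →
                    ∀ {x y k} → Walk G T x y k → f x ≤ k + f y
  potential-bound f lip (here _)     = ≤-refl
  potential-bound f lip (step s a r) =
    ≤-trans (lip _ _ s (walk-start r) a) (s≤s (potential-bound f lip r))

-- Breadth-first distances to a fixed vertex v inside a connected subset S
-- (vertices outside S get distance 0; no statement below concerns them).
module Distance (G : BipGraph) (S : VSet G) (conn : ConnectedOn G S)
                (v : Vertex G) (v∈S : S v ≡ true) where
  open Basics G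

  private
    Reaches : V → ℕ → Set
    Reaches w k = Walk G S w v k ⊎ S w ≡ false

    reachable : ∀ w → ∃ (Reaches w)
    reachable w with S w in e
    ... | true  = let k , p = conn w v e v∈S in k , inj₁ p
    ... | false = 0 , inj₂ refl

    shortest : ∀ w → Σ ℕ λ k → Reaches w k × (∀ j → Reaches w j → k ≤ j)
    shortest w = least-witness (λ k → walk? S k w v ⊎-dec (S w ≟ᵇ false)) (proj₂ (reachable w))

  -- dist is only used through the two properties below
  opaque
    dist : V → ℕ
    dist w = proj₁ (shortest w)

    dist-walk : ∀ {w} → w ∈ˢ S → Walk G S w v (dist w)
    dist-walk {w} w∈S with proj₁ (proj₂ (shortest w))
    ... | inj₁ p = p
    ... | inj₂ w∉S = ⊥-elim (true≢false (trans (sym w∈S) w∉S))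

    dist-min : ∀ {w k} → Walk G S w v k → dist w ≤ k
    dist-min {w} {k} p = proj₂ (proj₂ (shortest w)) k (inj₁ p)

  dist-root : dist v ≡ 0
  dist-root = n≤0⇒n≡0 (dist-min (here v∈S))

  dist-zero : ∀ {w} → w ∈ˢ S → dist w ≡ 0 → w ≡ v
  dist-zero w∈S e = walk-zero (subst (Walk G S _ v) e (dist-walk w∈S))

  dist-lip : ∀ {w w'} → w ∈ˢ S → w' ∈ˢ S → Adj G w w' → dist w ≤ suc (dist w')
  dist-lip w∈S w'∈S a = dist-min (step w∈S a (dist-walk w'∈S))

  dist-descend : ∀ {w j} → w ∈ˢ S → dist w ≡ suc j →
                 Σ V λ w' → w' ∈ˢ S × Adj G w w' × dist w' ≡ j
  dist-descend {w} {j} w∈S e with subst (Walk G S w v) e (dist-walk w∈S)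
  ... | step {v = w'} _ a r =
    w' , walk-start r , a ,
    ≤-antisym (dist-min r) (s≤s⁻¹ (subst (_≤ suc (dist w')) e (dist-lip w∈S (walk-start r) a)))

  equidistant-same-side : ∀ {w w'} → w ∈ˢ S → w' ∈ˢ S → dist w ≡ dist w' → side w ≡ side w'
  equidistant-same-side w∈S w'∈S e =
    trans (walk-parity (dist-walk w∈S))
          (trans (cong (λ d → side v xor parity d) e) (sym (walk-parity (dist-walk w'∈S))))

  adj-dist-differ : ∀ {w w'} → w ∈ˢ S → w' ∈ˢ S → Adj G w w' → dist w ≢ dist w'
  adj-dist-differ w∈S w'∈S a e = adj-sides a (equidistant-same-side w∈S w'∈S e)

module BDH (G : BipGraph) (bdh : IsBDH G) where
  open Basics G
  open import Data.List.Membership.DecPropositional _≟V_ using (_∈?_)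

  -- An induced path b – u – a – z – c has no shortcut b – t – c: inside the
  -- path, b and c are at distance 4, whereas a common neighbour t would make
  -- their distance in G equal to 2.
  P₅-no-shortcut : ∀ {b u a z c t} → Adj G b u → Adj G u a → Adj G a z → Adj G z c →
                   ¬ Adj G b z → ¬ Adj G u c → side b ≡ side a → side a ≡ side c →
                   Adj G b t → Adj G t c → ⊥
  P₅-no-shortcut {b} {u} {a} {z} {c} bu ua az zc ¬bz ¬uc ba ac bt tc =
    no-short-walk (Equivalence.to (bdh path path-connected b c (on-path b∈) (on-path c∈) 2)
                                  (2 , ≤-refl , step refl bt (step refl tc (here refl))))
    where
    L : List V
    L = b ∷ u ∷ a ∷ z ∷ c ∷ []
    b∈ : b ∈ L
    b∈ = here refl
    u∈ : u ∈ L
    u∈ = there (here refl)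
    a∈ : a ∈ L
    a∈ = there (there (here refl))
    z∈ : z ∈ L
    z∈ = there (there (there (here refl)))
    c∈ : c ∈ L
    c∈ = there (there (there (there (here refl))))
    path : VSet G
    path = ⟦ _∈? L ⟧
    on-path : ∀ {x} → x ∈ L → x ∈ˢ path
    on-path = ⟦⟧-intro (_∈? L)

    path-connected : ConnectedOn G path
    path-connected = connected-via path b reach
      where
      from-u : Walk G path u b 1
      from-u = step (on-path u∈) (adj-sym bu) (here (on-path b∈))
      from-a : Walk G path a b 2
      from-a = step (on-path a∈) (adj-sym ua) from-u
      from-z : Walk G path z b 3
      from-z = step (on-path z∈) (adj-sym az) from-a
      from-c : Walk G path c b 4
      from-c = step (on-path c∈) (adj-sym zc) from-z
      reach : ∀ x → x ∈ˢ path → ∃ λ k → Walk G path x b k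
      reach x x∈ with ⟦⟧-elim (_∈? L) {x} x∈
      ... | here refl                                 = _ , here x∈
      ... | there (here refl)                         = _ , from-u
      ... | there (there (here refl))                 = _ , from-a
      ... | there (there (there (here refl)))         = _ , from-z
      ... | there (there (there (there (here refl)))) = _ , from-c

    no-short-walk : ¬ DistLe G path b c 2
    no-short-walk (_ , _ , here _)                 = ¬bz (adj-sym zc)
    no-short-walk (_ , _ , step _ bc (here _))     = adj-sides bc (trans ba ac)
    no-short-walk (_ , _ , step {v = x} _ bx (step x∈ xc (here _))) with ⟦⟧-elim (_∈? L) {x} x∈
    ... | here refl                                 = adj-irrefl bx
    ... | there (here refl)                         = ¬uc xc
    ... | there (there (here refl))                 = adj-sides bx ba
    ... | there (there (there (here refl)))         = ¬bz bx
    ... | there (there (there (there (here refl)))) = adj-irrefl xc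
    no-short-walk (_ , s≤s (s≤s ()) , step _ _ (step _ _ (step _ _ _)))

  -- A vertex of S whose deletion the chain structure survives: a pendant
  -- vertex u of S with its unique neighbour w, or one of two twins a, b
  -- (vertices with the same neighbourhood in S) having a common neighbour u.
  data Reduction (S : VSet G) : Set where
    pendant : ∀ u w → u ∈ˢ S → w ∈ˢ S → Adj G u w →
              (∀ w' → w' ∈ˢ S → Adj G u w' → w' ≡ w) → Reduction S
    twins   : ∀ u a b → a ∈ˢ S → b ∈ˢ S → Adj G u a → Adj G u b → a ≢ b →
              (∀ z → z ∈ˢ S → Adj G a z → Adj G b z) →
              (∀ z → z ∈ˢ S → Adj G b z → Adj G a z) → Reduction S

  -- Every connected subset S with two distinct vertices p, q has a reduction
  -- (the pendant-or-twins property of distance-hereditary graphs).  We take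
  -- distances from p; let K be the largest one and u a vertex at distance K
  -- of minimum degree in S.  Then u is pendant, or any two neighbours of u
  -- are twins.
  module FarthestVertex (S : VSet G) (conn : ConnectedOn G S) {p q : V}
                        (p∈S : p ∈ˢ S) (q∈S : q ∈ˢ S) (p≢q : p ≢ q) where
    open Distance G S conn p p∈S

    farthest : Σ V λ u → u ∈ˢ S × (∀ w → w ∈ allVs → w ∈ˢ S → dist w ≤ dist u)
    farthest = maximiser (_∈ˢ? S) dist allVs p p∈S

    K : ℕ
    K = dist (proj₁ farthest)

    dist≤K : ∀ {w} → w ∈ˢ S → dist w ≤ K
    dist≤K {w} w∈S = proj₂ (proj₂ farthest) w (∈-allVs w) w∈S

    K-positive : 1 ≤ K
    K-positive with dist q in e
    ... | zero  = ⊥-elim (p≢q (sym (dist-zero q∈S e)))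
    ... | suc j = ≤-trans (s≤s z≤n) (subst (_≤ K) e (dist≤K q∈S))

    below-far : ∀ {w x} → w ∈ˢ S → x ∈ˢ S → dist w ≡ K → Adj G w x → suc (dist x) ≡ K
    below-far w∈S x∈S dw a =
      ≤-antisym (≤∧≢⇒< (dist≤K x∈S) (λ e → adj-dist-differ w∈S x∈S a (trans dw (sym e))))
                (subst (_≤ suc _) dw (dist-lip w∈S x∈S a))

    -- Claim: if w is at distance K with neighbours a and b, and a has a
    -- neighbour t at distance K - 2, then b is adjacent to t as well.
    -- For t ≠ p, suppose not.  The set T of vertices at distance ≤ K - 3, at
    -- distance K - 2 but not adjacent to b, and a, w, b is connected (through
    -- p, and b – w – a – t).  The potential equal to dist except K at w and
    -- K + 1 at b drops by at most one along edges of T, so inside T the vertex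
    -- b is at distance ≥ K + 1 from p, but in G it is at distance K - 1,
    -- contradicting distance-heredity.
    module NoMissedEdge {w a b t} (w∈S : w ∈ˢ S) (a∈S : a ∈ˢ S) (b∈S : b ∈ˢ S) (t∈S : t ∈ˢ S)
                        (dw : dist w ≡ K) (wa : Adj G w a) (wb : Adj G w b) (at : Adj G a t)
                        (dt : suc (suc (dist t)) ≡ K) (¬bt : ¬ Adj G b t)
                        (i : ℕ) (t≢p : dist t ≡ suc i) where
      K≥3 : 3 ≤ K
      K≥3 = subst (3 ≤_) (trans (cong (λ d → suc (suc d)) (sym t≢p)) dt) (s≤s (s≤s (s≤s z≤n)))

      db : suc (dist b) ≡ K
      db = below-far w∈S b∈S dw wb

      da : suc (dist a) ≡ K
      da = below-far w∈S a∈S dw wa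

      InT : V → Set
      InT x = x ∈ˢ S × ((3 + dist x ≤ K) ⊎ ((2 + dist x ≡ K) × ¬ Adj G x b) ⊎ x ≡ a ⊎ x ≡ w ⊎ x ≡ b)

      InT? : ∀ x → Dec (InT x)
      InT? x = x ∈ˢ? S ×-dec ((3 + dist x ≤? K) ⊎-dec ((2 + dist x ≟ K) ×-dec ¬? (adj? x b))
                              ⊎-dec (x ≟V a) ⊎-dec (x ≟V w) ⊎-dec (x ≟V b))

      T : VSet G
      T = ⟦ InT? ⟧

      T-in : ∀ {x} → InT x → x ∈ˢ T
      T-in = ⟦⟧-intro InT?

      T-out : ∀ {x} → x ∈ˢ T → InT x
      T-out {x} = ⟦⟧-elim InT? {x}

      T⊆S : ∀ {x} → x ∈ˢ T → x ∈ˢ S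
      T⊆S x∈T = proj₁ (T-out x∈T)

      descend : ∀ j x → dist x ≡ j → x ∈ˢ T → 2 + j ≤ K → ∃ λ k → Walk G T x p k
      descend zero x e x∈T _ = 0 , subst (λ y → Walk G T x y 0) (dist-zero (T⊆S x∈T) e) (here x∈T)
      descend (suc j) x e x∈T le with dist-descend (T⊆S x∈T) e
      ... | x' , x'∈S , xx' , e' =
        let k , r = descend j x' e' (T-in (x'∈S , inj₁ (subst (λ d → 3 + d ≤ K) (sym e') le)))
                            (≤-trans (n≤1+n _) le)
        in suc k , step x∈T xx' r

      t∈T : t ∈ˢ T
      t∈T = T-in (t∈S , inj₂ (inj₁ (dt , λ tb → ¬bt (adj-sym tb))))
      a∈T : a ∈ˢ T
      a∈T = T-in (a∈S , inj₂ (inj₂ (inj₁ refl)))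
      w∈T : w ∈ˢ T
      w∈T = T-in (w∈S , inj₂ (inj₂ (inj₂ (inj₁ refl))))
      b∈T : b ∈ˢ T
      b∈T = T-in (b∈S , inj₂ (inj₂ (inj₂ (inj₂ refl))))
      p∈T : p ∈ˢ T
      p∈T = T-in (p∈S , inj₁ (subst (λ d → 3 + d ≤ K) (sym dist-root) K≥3))

      T-connected : ConnectedOn G T
      T-connected = connected-via T p reach
        where
        from-a : ∃ λ k → Walk G T a p k
        from-a = let k , r = descend (dist t) t refl t∈T (≤-reflexive dt) in suc k , step a∈T at r
        from-w : ∃ λ k → Walk G T w p k
        from-w = suc (proj₁ from-a) , step w∈T wa (proj₂ from-a)
        reach : ∀ x → x ∈ˢ T → ∃ λ k → Walk G T x p k
        reach x x∈T with T-out x∈T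
        ... | _ , inj₁ le                           = descend (dist x) x refl x∈T (≤-trans (n≤1+n _) le)
        ... | _ , inj₂ (inj₁ (e , _))               = descend (dist x) x refl x∈T (≤-reflexive e)
        ... | _ , inj₂ (inj₂ (inj₁ refl))           = from-a
        ... | _ , inj₂ (inj₂ (inj₂ (inj₁ refl)))    = from-w
        ... | _ , inj₂ (inj₂ (inj₂ (inj₂ refl)))    = suc (proj₁ from-w) , step b∈T (adj-sym wb) (proj₂ from-w)

      potential : V → ℕ
      potential x with x ≟V b | x ≟V w
      ... | yes _ | _     = suc K
      ... | no _  | yes _ = K
      ... | no _  | no _  = dist x

      potential-b : potential b ≡ suc K
      potential-b with b ≟V b
      ... | yes _ = refl
      ... | no b≢b = ⊥-elim (b≢b refl)

      potential-dist : ∀ {x} → x ≢ b → potential x ≡ dist x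
      potential-dist {x} x≢b with x ≟V b | x ≟V w
      ... | yes e    | _     = ⊥-elim (x≢b e)
      ... | no _     | yes refl = sym dw
      ... | no _     | no _  = refl

      dist≤potential : ∀ {x} → x ∈ˢ S → dist x ≤ potential x
      dist≤potential {x} x∈S with x ≟V b | x ≟V w
      ... | yes _ | _     = ≤-trans (dist≤K x∈S) (n≤1+n K)
      ... | no _  | yes _ = dist≤K x∈S
      ... | no _  | no _  = ≤-refl

      b-neighbours : ∀ {t'} → t' ∈ˢ T → Adj G b t' → K ≤ dist t'
      b-neighbours {t'} t'∈T bt' with T-out t'∈T
      ... | t'∈S , inj₁ le = ⊥-elim (<⇒≱ le (subst (_≤ 2 + dist t') db (s≤s (dist-lip b∈S t'∈S bt'))))
      ... | _ , inj₂ (inj₁ (_ , ¬t'b))        = ⊥-elim (¬t'b (adj-sym bt'))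
      ... | _ , inj₂ (inj₂ (inj₁ refl))        =
        ⊥-elim (adj-sides bt' (equidistant-same-side b∈S a∈S (suc-injective (trans db (sym da)))))
      ... | _ , inj₂ (inj₂ (inj₂ (inj₁ refl))) = ≤-reflexive (sym dw)
      ... | _ , inj₂ (inj₂ (inj₂ (inj₂ refl))) = ⊥-elim (adj-irrefl bt')

      potential-lip : ∀ s t' → s ∈ˢ T → t' ∈ˢ T → Adj G s t' → potential s ≤ suc (potential t')
      potential-lip s t' s∈T t'∈T st' = by-cases (s ≟V b)
        where
        by-cases : Dec (s ≡ b) → potential s ≤ suc (potential t')
        by-cases (no s≢b) =
          subst (_≤ suc (potential t')) (sym (potential-dist s≢b))
                (≤-trans (dist-lip (T⊆S s∈T) (T⊆S t'∈T) st') (s≤s (dist≤potential (T⊆S t'∈T))))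
        by-cases (yes refl) =
          subst (_≤ suc (potential t')) (sym potential-b)
                (s≤s (subst (K ≤_) (sym (potential-dist (λ e → adj-irrefl (subst (Adj G b) e st'))))
                            (b-neighbours t'∈T st')))

      p≢b : p ≢ b
      p≢b e with subst (3 ≤_) (trans (sym db) (cong suc (trans (cong dist (sym e)) dist-root))) K≥3
      ... | s≤s ()

      absurd : ⊥
      absurd with Equivalence.to (bdh T T-connected b p b∈T p∈T (dist b))
                                 (dist b , ≤-refl , walk-in-G (dist-walk b∈S))
      ... | k , k≤ , r = <⇒≱ k<K (≤-trans (n≤1+n K) K<k)
        where
        K<k : suc K ≤ k
        K<k = subst₂ _≤_ potential-b
                (trans (cong (k +_) (trans (potential-dist p≢b) dist-root)) (+-identityʳ k))
                (potential-bound potential potential-lip r)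
        k<K : k < K
        k<K = ≤-<-trans k≤ (subst (dist b <_) db (n<1+n (dist b)))

    no-missed-edge : ∀ {w a b t} → w ∈ˢ S → a ∈ˢ S → b ∈ˢ S → t ∈ˢ S → dist w ≡ K →
                     Adj G w a → Adj G w b → Adj G a t → suc (suc (dist t)) ≡ K → Adj G b t
    no-missed-edge {w} {a} {b} {t} w∈S a∈S b∈S t∈S dw wa wb at dt with adj? b t | dist t in et
    ... | yes bt | _     = bt
    ... | no ¬bt | suc i =
      ⊥-elim (NoMissedEdge.absurd w∈S a∈S b∈S t∈S dw wa wb at (trans (cong (λ d → suc (suc d)) et) dt) ¬bt i et)
    ... | no ¬bt | zero = adjacent-to-p
      where
      -- here t = p and K = 2, so b (at distance 1) is adjacent to p
      K≡2 : K ≡ 2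
      K≡2 = sym dt
      adjacent-to-p : Adj G b t
      adjacent-to-p with dist-descend b∈S (suc-injective (trans (below-far w∈S b∈S dw wb) K≡2))
      ... | t' , t'∈S , bt' , d0 = subst (Adj G b) (trans (dist-zero t'∈S d0) (sym (dist-zero t∈S et))) bt'

    N : V → VSet G
    N w = ⟦ (λ z → z ∈ˢ? S ×-dec adj? w z) ⟧

    degree : V → ℕ
    degree w = size (N w)

    chosen : Σ V λ u → (u ∈ˢ S × dist u ≡ K) × degree u ≤ degree (proj₁ farthest) ×
                       (∀ w → w ∈ allVs → w ∈ˢ S × dist w ≡ K → degree u ≤ degree w)
    chosen = minimiser (λ w → w ∈ˢ? S ×-dec (dist w ≟ K)) degree allVs
                       (proj₁ farthest) (proj₁ (proj₂ farthest) , refl)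

    u : V
    u = proj₁ chosen

    u∈S : u ∈ˢ S
    u∈S = proj₁ (proj₁ (proj₂ chosen))

    du : dist u ≡ K
    du = proj₂ (proj₁ (proj₂ chosen))

    min-degree : ∀ {w} → w ∈ˢ S → dist w ≡ K → degree u ≤ degree w
    min-degree {w} w∈S dw = proj₂ (proj₂ (proj₂ chosen)) w (∈-allVs w) (w∈S , dw)

    -- By minimality of its degree, N(u) is not a proper superset of the
    -- neighbourhood of another vertex z at distance K.
    escapes : ∀ {z b} → z ∈ˢ S → dist z ≡ K → b ∈ˢ S → Adj G u b → ¬ Adj G z b →
              Σ V λ c → c ∈ˢ S × Adj G z c × ¬ Adj G u c
    escapes {z} {b} z∈S dz b∈S ub ¬zb with anyV (λ c → c ∈ˢ? S ×-dec adj? z c ×-dec ¬? (adj? u c))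
    ... | yes found = found
    ... | no none   = ⊥-elim (<⇒≱ N[z]⊂N[u] (min-degree z∈S dz))
      where
      N[z]⊆N[u] : ∀ c → c ∈ˢ N z → c ∈ˢ N u
      N[z]⊆N[u] c c∈ = include (⟦⟧-elim (λ c → c ∈ˢ? S ×-dec adj? z c) {c} c∈) (adj? u c)
        where
        include : c ∈ˢ S × Adj G z c → Dec (Adj G u c) → c ∈ˢ N u
        include (c∈S , zc) (yes uc) = ⟦⟧-intro (λ c → c ∈ˢ? S ×-dec adj? u c) (c∈S , uc)
        include (c∈S , zc) (no ¬uc) = ⊥-elim (none (c , c∈S , zc , ¬uc))
      N[z]⊂N[u] : degree z < degree u
      N[z]⊂N[u] = count-strict (N z) (N u) N[z]⊆N[u] (∈-allVs b)
                    (⟦⟧-intro (λ c → c ∈ˢ? S ×-dec adj? u c) (b∈S , ub))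
                    (⟦⟧-out (λ c → c ∈ˢ? S ×-dec adj? z c) (¬zb ∘ proj₂))

    -- Two neighbours a, b of u agree on neighbours z at distance K: otherwise
    -- z has a neighbour c outside N(u), b has a neighbour t at distance K - 2,
    -- the claim gives a – t and c – t, and b – u – a – z – c would be an
    -- induced path with shortcut b – t – c.
    same-level : ∀ {a b z} → a ∈ˢ S → b ∈ˢ S → z ∈ˢ S → Adj G u a → Adj G u b → a ≢ b →
                 Adj G a z → dist z ≡ K → Adj G b z
    same-level {a} {b} {z} a∈S b∈S z∈S ua ub a≢b az dz with adj? b z
    ... | yes bz = bz
    ... | no ¬bz with escapes z∈S dz b∈S ub (¬bz ∘ adj-sym) | dist b in eb
    ...   | _ | zero = ⊥-elim (a≢b (trans (dist-zero a∈S da≡0) (sym (dist-zero b∈S eb))))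
      where
      da≡0 : dist a ≡ 0
      da≡0 = suc-injective (trans (below-far u∈S a∈S du ua) (trans (sym (below-far u∈S b∈S du ub)) (cong suc eb)))
    ...   | c , c∈S , zc , ¬uc | suc j with dist-descend b∈S eb
    ...     | t , t∈S , bt , dt≡j =
      ⊥-elim (P₅-no-shortcut (adj-sym ub) ua az zc ¬bz ¬uc b~a a~c bt (adj-sym ct))
      where
      dt : suc (suc (dist t)) ≡ K
      dt = trans (cong (λ d → suc (suc d)) dt≡j) (trans (cong suc (sym eb)) (below-far u∈S b∈S du ub))
      at : Adj G a t
      at = no-missed-edge u∈S b∈S a∈S t∈S du ub ua bt dt
      ct : Adj G c t
      ct = no-missed-edge z∈S a∈S c∈S t∈S dz (adj-sym az) zc at dt
      b~a : side b ≡ side a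
      b~a = equidistant-same-side b∈S a∈S
              (suc-injective (trans (below-far u∈S b∈S du ub) (sym (below-far u∈S a∈S du ua))))
      a~c : side a ≡ side c
      a~c = equidistant-same-side a∈S c∈S
              (suc-injective (trans (below-far u∈S a∈S du ua) (sym (below-far z∈S c∈S dz zc))))

    -- Hence any two neighbours of u are twins: a neighbour z of a lies at
    -- distance K - 2 (claim) or K (previous lemma).
    twin-neighbours : ∀ {a b z} → a ∈ˢ S → b ∈ˢ S → z ∈ˢ S → Adj G u a → Adj G u b → a ≢ b →
                      Adj G a z → Adj G b z
    twin-neighbours {a} {b} {z} a∈S b∈S z∈S ua ub a≢b az with <-cmp (dist z) (dist a)
    ... | tri< dz<da _ _ =
      no-missed-edge u∈S a∈S b∈S z∈S du ua ub az
        (trans (cong suc (≤-antisym dz<da (dist-lip a∈S z∈S az))) (below-far u∈S a∈S du ua))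
    ... | tri≈ _ e _ = ⊥-elim (adj-dist-differ a∈S z∈S az (sym e))
    ... | tri> _ _ dz>da =
      same-level a∈S b∈S z∈S ua ub a≢b az
        (trans (≤-antisym (dist-lip z∈S a∈S (adj-sym az)) dz>da) (below-far u∈S a∈S du ua))

    reduction : Reduction S
    reduction with dist u in eu
    ... | zero = ⊥-elim (<⇒≱ K-positive (≤-reflexive (trans (sym du) eu)))
    ... | suc j with dist-descend u∈S eu
    ...   | a , a∈S , ua , _ with anyV (λ b → b ∈ˢ? S ×-dec adj? u b ×-dec ¬? (b ≟V a))
    ...     | yes (b , b∈S , ub , b≢a) =
      twins u a b a∈S b∈S ua ub (b≢a ∘ sym)
            (λ z z∈S az → twin-neighbours a∈S b∈S z∈S ua ub (b≢a ∘ sym) az)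
            (λ z z∈S bz → twin-neighbours b∈S a∈S z∈S ub ua b≢a bz)
    ...     | no none = pendant u a u∈S a∈S ua unique
      where
      unique : ∀ w' → w' ∈ˢ S → Adj G u w' → w' ≡ a
      unique w' w'∈S uw' with w' ≟V a
      ... | yes e = e
      ... | no w'≢a = ⊥-elim (none (w' , w'∈S , uw' , w'≢a))

module Deletion (G : BipGraph) where
  open Basics G

  -- Deletion is opaque so that S and u can be recovered from S ∖ u.
  opaque
    _∖_ : VSet G → V → VSet G
    S ∖ u = ⟦ (λ x → x ∈ˢ? S ×-dec ¬? (x ≟V u)) ⟧

    ∖-intro : ∀ {S u x} → x ∈ˢ S → x ≢ u → x ∈ˢ (S ∖ u)
    ∖-intro {S} {u} x∈S x≢u = ⟦⟧-intro (λ x → x ∈ˢ? S ×-dec ¬? (x ≟V u)) (x∈S , x≢u)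

    ∖-elim : ∀ {S u x} → x ∈ˢ (S ∖ u) → x ∈ˢ S × x ≢ u
    ∖-elim {S} {u} {x} = ⟦⟧-elim (λ x → x ∈ˢ? S ×-dec ¬? (x ≟V u)) {x}

    size-∖ : ∀ {S u} → u ∈ˢ S → size (S ∖ u) < size S
    size-∖ {S} {u} u∈S = count-strict (S ∖ u) S (λ _ x∈ → proj₁ (∖-elim {S} {u} x∈)) (∈-allVs u) u∈S
                           (⟦⟧-out (λ x → x ∈ˢ? S ×-dec ¬? (x ≟V u)) (λ (_ , u≢u) → u≢u refl))

  connected-∖ : ∀ {S u} → ConnectedOn G S →
                (∀ w₁ w₂ → w₁ ∈ˢ S → w₂ ∈ˢ S → Adj G w₁ u → Adj G u w₂ →
                   ∃ λ k → Walk G (S ∖ u) w₁ w₂ k) →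
                ConnectedOn G (S ∖ u)
  connected-∖ {S} {u} conn bypass x y x∈ y∈ =
    reroute (proj₂ (conn x y (proj₁ (∖-elim x∈)) (proj₁ (∖-elim y∈)))) (proj₂ (∖-elim x∈)) (proj₂ (∖-elim y∈))
    where
    reroute : ∀ {a b k} → Walk G S a b k → a ≢ u → b ≢ u → ∃ λ k' → Walk G (S ∖ u) a b k'
    reroute (here a∈) a≢u b≢u = 0 , here (∖-intro a∈ a≢u)
    reroute (step {v = c} a∈ ac r) a≢u b≢u with c ≟V u
    ... | no c≢u = let k , r' = reroute r c≢u b≢u in suc k , step (∖-intro a∈ a≢u) ac r'
    reroute (step a∈ ac (here _))    a≢u b≢u | yes refl = ⊥-elim (b≢u refl)
    reroute (step a∈ ac (step _ ud r)) a≢u b≢u | yes refl =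
      let _ , around = bypass _ _ a∈ (walk-start r) ac ud
          _ , rest   = reroute r (λ e → adj-irrefl (subst (Adj G u) e ud)) b≢u
      in _ , around ++ʷ rest

module Representation (G : BipGraph) where
  open Basics G
  open Deletion G

  Parents : Set
  Parents = Fin m → Maybe (Fin m)

  record NeighbourChain (par : Parents) (S : VSet G) (y : Fin n) : Set where
    constructor neighbourChain
    field
      members  : List (Fin m)
      is-chain : ParentChain par members
      sound    : ∀ i → i ∈ members → E i y ≡ true × inj₁ i ∈ˢ S
      complete : ∀ i → E i y ≡ true → inj₁ i ∈ˢ S → i ∈ members

  record ChainRep (S : VSet G) : Set where
    field
      par      : Parents
      rank     : Fin m → ℕ
      rank-par : ∀ x p → par x ≡ just p → rank p < rank x
      par∈S    : ∀ x p → par x ≡ just p → inj₁ p ∈ˢ S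
      chain-of : ∀ y → inj₂ y ∈ˢ S → NeighbourChain par S y

  transfer : ∀ {par par' S S' y} (c : NeighbourChain par S' y) →
             (∀ j → j ∈ NeighbourChain.members c → par' j ≡ par j) →
             (∀ i → inj₁ i ∈ˢ S' → inj₁ i ∈ˢ S) →
             (∀ i → E i y ≡ true → inj₁ i ∈ˢ S → inj₁ i ∈ˢ S') →
             NeighbourChain par' S y
  transfer (neighbourChain cs ch sound complete) agree S'⊆S back =
    neighbourChain cs (rechain-all ch agree)
                   (λ i i∈ → let yi , i∈S' = sound i i∈ in yi , S'⊆S i i∈S')
                   (λ i yi i∈S → complete i yi (back i yi i∈S))

  trivial-rep : ∀ S → (∀ v w → v ∈ˢ S → w ∈ˢ S → v ≡ w) → ChainRep S
  trivial-rep S at-most-one = record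
    { par = λ _ → nothing ; rank = λ _ → 0 ; rank-par = λ _ _ () ; par∈S = λ _ _ ()
    ; chain-of = λ y y∈S → neighbourChain [] empty (λ _ ()) (λ i _ i∈S → ⊥-elim (X≢Y (at-most-one _ _ i∈S y∈S))) }
    where X≢Y : ∀ {i y} → inj₁ i ≢ inj₂ y
          X≢Y ()

  extend-Y : ∀ {S y₀} (R : ChainRep (S ∖ inj₂ y₀)) → NeighbourChain (ChainRep.par R) S y₀ →
             ChainRep S
  extend-Y {S} {y₀} R c₀ = record
    { par = par ; rank = rank ; rank-par = rank-par
    ; par∈S = λ x p e → proj₁ (∖-elim (par∈S x p e)) ; chain-of = chain-of' }
    where
    open ChainRep R
    chain-of' : ∀ y → inj₂ y ∈ˢ S → NeighbourChain par S y
    chain-of' y y∈S with y Fin.≟ y₀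
    ... | yes refl = c₀
    ... | no y≢y₀  = transfer (chain-of y (∖-intro y∈S (y≢y₀ ∘ Sum.inj₂-injective))) (λ _ _ → refl)
                              (λ i i∈ → proj₁ (∖-elim i∈)) (λ i _ i∈S → ∖-intro i∈S λ ())

  ≢-deleted : ∀ {S x₀ i} → inj₁ i ∈ˢ (S ∖ inj₁ x₀) → i ≢ x₀
  ≢-deleted i∈ refl = proj₂ (∖-elim i∈) refl

  reinsert-X : ∀ {par par' S x₀ y} (c : NeighbourChain par (S ∖ inj₁ x₀) y) →
               (∀ j → j ∈ NeighbourChain.members c → inj₁ j ∈ˢ (S ∖ inj₁ x₀) → par' j ≡ par j) →
               ¬ E x₀ y ≡ true → NeighbourChain par' S y
  reinsert-X {x₀ = x₀} {y} c agree x₀∉N =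
    transfer c (λ j j∈ → agree j j∈ (proj₂ (NeighbourChain.sound c j j∈)))
      (λ i i∈ → proj₁ (∖-elim i∈))
      (λ i iy i∈S → ∖-intro i∈S λ e → x₀∉N (subst (λ i → E i y ≡ true) (Sum.inj₁-injective e) iy))

  -- A pendant vertex x₀ ∈ X with unique neighbour y₀ is re-inserted as a
  -- child of the last element of the chain of y₀.
  module PendantX {S x₀ y₀} (x₀∈S : inj₁ x₀ ∈ˢ S) (y₀∈S : inj₂ y₀ ∈ˢ S) (x₀y₀ : E x₀ y₀ ≡ true)
                  (only-y₀ : ∀ w → w ∈ˢ S → Adj G (inj₁ x₀) w → w ≡ inj₂ y₀)
                  (R : ChainRep (S ∖ inj₁ x₀)) where
    open ChainRep R
    open NeighbourChain (chain-of y₀ (∖-intro y₀∈S λ ())) renaming (members to cs₀)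

    above : Maybe (Fin m) → ℕ
    above nothing  = 0
    above (just l) = suc (rank l)

    par' : Parents
    par' = updateAt par x₀ (const (last cs₀))

    rank' : Fin m → ℕ
    rank' = updateAt rank x₀ (const (above (last cs₀)))

    par'-other : ∀ {z} → z ≢ x₀ → par' z ≡ par z
    par'-other {z} = updateAt-minimal z x₀ par

    rank'-other : ∀ {z} → z ≢ x₀ → rank' z ≡ rank z
    rank'-other {z} = updateAt-minimal z x₀ rank

    new-parent∈ : ∀ {p} → last cs₀ ≡ just p → inj₁ p ∈ˢ (S ∖ inj₁ x₀)
    new-parent∈ e = proj₂ (sound _ (last-∈ cs₀ e))

    rank-par' : ∀ z p → par' z ≡ just p → rank' p < rank' z
    rank-par' z p e with z Fin.≟ x₀
    ... | yes refl = let e' = trans (sym (updateAt-updates x₀ par)) e in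
      subst₂ _<_ (sym (rank'-other (≢-deleted (new-parent∈ e'))))
                 (sym (trans (updateAt-updates x₀ rank) (cong above e'))) (n<1+n (rank p))
    ... | no z≢x₀  = let e' = trans (sym (par'-other z≢x₀)) e in
      subst₂ _<_ (sym (rank'-other (≢-deleted (par∈S z p e')))) (sym (rank'-other z≢x₀)) (rank-par z p e')

    par'∈S : ∀ z p → par' z ≡ just p → inj₁ p ∈ˢ S
    par'∈S z p e with z Fin.≟ x₀
    ... | yes refl = proj₁ (∖-elim (new-parent∈ (trans (sym (updateAt-updates x₀ par)) e)))
    ... | no z≢x₀  = proj₁ (∖-elim (par∈S z p (trans (sym (par'-other z≢x₀)) e)))

    chain-y₀ : NeighbourChain par' S y₀
    chain-y₀ = neighbourChain (cs₀ ++ x₀ ∷ [])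
      (chain-snoc (rechain-all is-chain λ j j∈ → par'-other (≢-deleted (proj₂ (sound j j∈))))
                  x₀ (updateAt-updates x₀ par))
      sound' complete'
      where
      sound' : ∀ i → i ∈ cs₀ ++ x₀ ∷ [] → E i y₀ ≡ true × inj₁ i ∈ˢ S
      sound' i i∈ with ∈-++⁻ cs₀ i∈
      ... | inj₁ i∈cs₀       = proj₁ (sound i i∈cs₀) , proj₁ (∖-elim (proj₂ (sound i i∈cs₀)))
      ... | inj₂ (here refl) = x₀y₀ , x₀∈S
      complete' : ∀ i → E i y₀ ≡ true → inj₁ i ∈ˢ S → i ∈ cs₀ ++ x₀ ∷ []
      complete' i iy₀ i∈S with i Fin.≟ x₀
      ... | yes refl = ∈-++⁺ʳ cs₀ (here refl)
      ... | no i≢x₀  = ∈-++⁺ˡ (complete i iy₀ (∖-intro i∈S (i≢x₀ ∘ Sum.inj₁-injective)))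

    extended : ChainRep S
    extended = record { par = par' ; rank = rank' ; rank-par = rank-par' ; par∈S = par'∈S ; chain-of = chain-of' }
      where
      chain-of' : ∀ y → inj₂ y ∈ˢ S → NeighbourChain par' S y
      chain-of' y y∈S with y Fin.≟ y₀
      ... | yes refl = chain-y₀
      ... | no y≢y₀ = reinsert-X (ChainRep.chain-of R y (∖-intro y∈S λ ()))
                        (λ j j∈ j∈S → par'-other (≢-deleted j∈S))
                        (λ x₀y → y≢y₀ (Sum.inj₂-injective (only-y₀ (inj₂ y) y∈S x₀y)))

  -- A twin x₀ ∈ X of x₁ (same neighbours in S) is re-inserted as the new
  -- parent of x₁, taking over the old parent of x₁; in every chain through
  -- x₁ it is inserted just before x₁.  Ranks are doubled to make room.
  module TwinX {S x₀ x₁} (x₀∈S : inj₁ x₀ ∈ˢ S) (x₁∈S : inj₁ x₁ ∈ˢ S) (x₀≢x₁ : x₀ ≢ x₁)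
               (twin₀₁ : ∀ y → inj₂ y ∈ˢ S → E x₀ y ≡ true → E x₁ y ≡ true)
               (twin₁₀ : ∀ y → inj₂ y ∈ˢ S → E x₁ y ≡ true → E x₀ y ≡ true)
               (R : ChainRep (S ∖ inj₁ x₀)) where
    open ChainRep R

    double : Fin m → ℕ
    double z = rank z + rank z

    par₀ par' : Parents
    par₀ = updateAt par x₀ (const (par x₁))
    par' = updateAt par₀ x₁ (const (just x₀))

    rank₀ rank' : Fin m → ℕ
    rank₀ = updateAt double x₀ (const (double x₁))
    rank' = updateAt rank₀ x₁ (const (suc (double x₁)))

    par'-x₀ : par' x₀ ≡ par x₁
    par'-x₀ = trans (updateAt-minimal x₀ x₁ {const (just x₀)} par₀ x₀≢x₁) (updateAt-updates x₀ {const (par x₁)} par)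

    par'-x₁ : par' x₁ ≡ just x₀
    par'-x₁ = updateAt-updates x₁ {const (just x₀)} par₀

    par'-other : ∀ {z} → z ≢ x₀ → z ≢ x₁ → par' z ≡ par z
    par'-other {z} z≢x₀ z≢x₁ =
      trans (updateAt-minimal z x₁ {const (just x₀)} par₀ z≢x₁) (updateAt-minimal z x₀ {const (par x₁)} par z≢x₀)

    rank'-x₀ : rank' x₀ ≡ double x₁
    rank'-x₀ = trans (updateAt-minimal x₀ x₁ {const (suc (double x₁))} rank₀ x₀≢x₁) (updateAt-updates x₀ {const (double x₁)} double)

    rank'-x₁ : rank' x₁ ≡ suc (double x₁)
    rank'-x₁ = updateAt-updates x₁ {const (suc (double x₁))} rank₀

    rank'-other : ∀ {z} → z ≢ x₀ → z ≢ x₁ → rank' z ≡ double z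
    rank'-other {z} z≢x₀ z≢x₁ =
      trans (updateAt-minimal z x₁ {const (suc (double x₁))} rank₀ z≢x₁) (updateAt-minimal z x₀ {const (double x₁)} double z≢x₀)

    double-< : ∀ {a b} → rank a < rank b → double a < double b
    double-< lt = +-mono-< lt lt

    double-<-suc : ∀ {a b} → rank a < rank b → suc (double a) < double b
    double-<-suc {a} {b} lt = subst (_≤ double b) (cong suc (+-suc (rank a) (rank a))) (+-mono-≤ lt lt)

    <-≢ : ∀ {p z} → rank p < rank z → p ≢ z
    <-≢ lt refl = <-irrefl refl lt

    rank-par' : ∀ z p → par' z ≡ just p → rank' p < rank' z
    rank-par' z p e with z Fin.≟ x₀ | z Fin.≟ x₁
    ... | yes refl | _ =
      let e' = trans (sym par'-x₀) e ; lt = rank-par x₁ p e' in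
      subst₂ _<_ (sym (rank'-other (≢-deleted (par∈S x₁ p e')) (<-≢ lt))) (sym rank'-x₀) (double-< lt)
    ... | no _ | yes refl =
      subst₂ _<_ (sym (trans (cong rank' (sym (just-injective (trans (sym par'-x₁) e)))) rank'-x₀)) (sym rank'-x₁)
             (n<1+n _)
    ... | no z≢x₀ | no z≢x₁ with p Fin.≟ x₁
    ...   | yes refl = subst₂ _<_ (sym rank'-x₁) (sym (rank'-other z≢x₀ z≢x₁)) (double-<-suc (rank-par z x₁ e'))
      where e' = trans (sym (par'-other z≢x₀ z≢x₁)) e
    ...   | no p≢x₁  = subst₂ _<_ (sym (rank'-other (≢-deleted (par∈S z p e')) p≢x₁)) (sym (rank'-other z≢x₀ z≢x₁))
                              (double-< (rank-par z p e'))
      where e' = trans (sym (par'-other z≢x₀ z≢x₁)) e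

    par'∈S : ∀ z p → par' z ≡ just p → inj₁ p ∈ˢ S
    par'∈S z p e with z Fin.≟ x₀ | z Fin.≟ x₁
    ... | yes refl | _        = proj₁ (∖-elim (par∈S x₁ p (trans (sym par'-x₀) e)))
    ... | no _     | yes refl = subst (λ q → inj₁ q ∈ˢ S) (just-injective (trans (sym par'-x₁) e)) x₀∈S
    ... | no z≢x₀  | no z≢x₁  = proj₁ (∖-elim (par∈S z p (trans (sym (par'-other z≢x₀ z≢x₁)) e)))

    after-x₁ : ∀ {cs j} → ParentChain par (x₁ ∷ cs) → j ∈ cs → inj₁ j ∈ˢ (S ∖ inj₁ x₀) → par' j ≡ par j
    after-x₁ ch j∈ j∈S = par'-other (≢-deleted j∈S) (<-≢ (chain-rank rank rank-par ch _ j∈) ∘ sym)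

    insert : List (Fin m) → List (Fin m)
    insert []       = []
    insert (c ∷ cs) with c Fin.≟ x₁
    ... | yes _ = x₀ ∷ c ∷ cs
    ... | no  _ = c ∷ insert cs

    insert-⊆ : ∀ cs {i} → i ∈ insert cs → i ∈ cs ⊎ i ≡ x₀
    insert-⊆ (c ∷ cs) i∈ with c Fin.≟ x₁ | i∈
    ... | yes _ | here refl  = inj₂ refl
    ... | yes _ | there i∈'  = inj₁ i∈'
    ... | no _  | here refl  = inj₁ (here refl)
    ... | no _  | there i∈'  = map₁ there (insert-⊆ cs i∈')

    ⊆-insert : ∀ cs {i} → i ∈ cs → i ∈ insert cs
    ⊆-insert (c ∷ cs) i∈ with c Fin.≟ x₁ | i∈
    ... | yes _ | _          = there i∈
    ... | no _  | here refl  = here refl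
    ... | no _  | there i∈'  = there (⊆-insert cs i∈')

    x₀-inserted : ∀ cs → x₁ ∈ cs → x₀ ∈ insert cs
    x₀-inserted (c ∷ cs) x₁∈ with c Fin.≟ x₁ | x₁∈
    ... | yes _  | _          = here refl
    ... | no c≢x₁ | here e    = ⊥-elim (c≢x₁ (sym e))
    ... | no _   | there x₁∈' = there (x₀-inserted cs x₁∈')

    insert-chain : ∀ {c cs} → ParentChain par (c ∷ cs) → (∀ j → j ∈ c ∷ cs → inj₁ j ∈ˢ (S ∖ inj₁ x₀)) →
                   ParentChain par' (insert (c ∷ cs)) ×
                   (∀ {i} → par c ≡ just i → ParentChain par' (i ∷ insert (c ∷ cs)))
    insert-chain {c} {cs} ch in-S with c Fin.≟ x₁
    ... | yes refl = from-x₀ , λ e → link (trans par'-x₀ e) from-x₀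
      where
      from-x₀ : ParentChain par' (x₀ ∷ c ∷ cs)
      from-x₀ = link par'-x₁ (rechain ch (λ j j∈ → after-x₁ ch j∈ (in-S j (there j∈))))
    insert-chain (single c) in-S | no c≢x₁ =
      single c , λ e → link (trans (par'-other (≢-deleted (in-S c (here refl))) c≢x₁) e) (single c)
    insert-chain {c} (link e ch) in-S | no c≢x₁ =
      let _ , below = insert-chain ch (λ j → in-S j ∘ there) in
      below e , λ e' → link (trans (par'-other (≢-deleted (in-S c (here refl))) c≢x₁) e') (below e)

    chain-through-x₁ : ∀ {y} → inj₂ y ∈ˢ S → E x₁ y ≡ true → NeighbourChain par (S ∖ inj₁ x₀) y →
                       NeighbourChain par' S y
    chain-through-x₁ {y} y∈S x₁y (neighbourChain cs ch sound complete) =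
      neighbourChain (insert cs) (chain cs ch sound) sound' complete'
      where
      chain : ∀ cs → ParentChain par cs → (∀ j → j ∈ cs → E j y ≡ true × inj₁ j ∈ˢ (S ∖ inj₁ x₀)) →
              ParentChain par' (insert cs)
      chain []       _  _     = empty
      chain (c ∷ cs) ch sound = proj₁ (insert-chain ch (λ j → proj₂ ∘ sound j))
      sound' : ∀ i → i ∈ insert cs → E i y ≡ true × inj₁ i ∈ˢ S
      sound' i i∈ with insert-⊆ cs i∈
      ... | inj₁ i∈cs = proj₁ (sound i i∈cs) , proj₁ (∖-elim (proj₂ (sound i i∈cs)))
      ... | inj₂ refl = twin₁₀ y y∈S x₁y , x₀∈S
      complete' : ∀ i → E i y ≡ true → inj₁ i ∈ˢ S → i ∈ insert cs
      complete' i iy i∈S with i Fin.≟ x₀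
      ... | yes refl = x₀-inserted cs (complete x₁ x₁y (∖-intro x₁∈S (x₀≢x₁ ∘ sym ∘ Sum.inj₁-injective)))
      ... | no i≢x₀  = ⊆-insert cs (complete i iy (∖-intro i∈S (i≢x₀ ∘ Sum.inj₁-injective)))

    extended : ChainRep S
    extended = record { par = par' ; rank = rank' ; rank-par = rank-par' ; par∈S = par'∈S ; chain-of = chain-of' }
      where
      chain-of' : ∀ y → inj₂ y ∈ˢ S → NeighbourChain par' S y
      chain-of' y y∈S with E x₁ y in x₁y
      ... | true  = chain-through-x₁ y∈S x₁y (chain-of y (∖-intro y∈S λ ()))
      ... | false = reinsert-X c (λ j j∈ j∈S → par'-other (≢-deleted j∈S) (x₁∉c j∈))
                               (λ x₀y → x₁∉N (twin₀₁ y y∈S x₀y))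
        where
        c : NeighbourChain par (S ∖ inj₁ x₀) y
        c = chain-of y (∖-intro y∈S λ ())
        x₁∉N : ¬ E x₁ y ≡ true
        x₁∉N x₁y' = true≢false (trans (sym x₁y') x₁y)
        x₁∉c : ∀ {j} → j ∈ NeighbourChain.members c → j ≢ x₁
        x₁∉c j∈ refl = x₁∉N (proj₁ (NeighbourChain.sound c _ j∈))

-- Every connected vertex subset of a BDH graph has a chain representation,
-- by induction on its size: delete a pendant vertex or a twin (which keeps
-- the subset connected), represent the rest, and re-insert the vertex.
module Construction (G : BipGraph) (bdh : IsBDH G) where
  open Basics G
  open Deletion G
  open BDH G bdh
  open Representation G

  reinsert-pendant : ∀ {S} u w → u ∈ˢ S → w ∈ˢ S → Adj G u w →
                     (∀ w' → w' ∈ˢ S → Adj G u w' → w' ≡ w) → ChainRep (S ∖ u) → ChainRep S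
  reinsert-pendant (inj₁ x₀) (inj₂ y₀) u∈S w∈S uw only R = PendantX.extended u∈S w∈S uw only R
  reinsert-pendant {S} (inj₂ y₀) (inj₁ x₀) u∈S w∈S uw only R =
    extend-Y R (neighbourChain (x₀ ∷ []) (single x₀) sound complete)
    where
    sound : ∀ i → i ∈ x₀ ∷ [] → E i y₀ ≡ true × inj₁ i ∈ˢ S
    sound i (here refl) = uw , w∈S
    complete : ∀ i → E i y₀ ≡ true → inj₁ i ∈ˢ S → i ∈ x₀ ∷ []
    complete i iy₀ i∈S = here (Sum.inj₁-injective (only (inj₁ i) i∈S iy₀))

  reinsert-twin : ∀ {S} u a b → a ∈ˢ S → b ∈ˢ S → Adj G u a → Adj G u b → a ≢ b →
                  (∀ z → z ∈ˢ S → Adj G a z → Adj G b z) → (∀ z → z ∈ˢ S → Adj G b z → Adj G a z) →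
                  ChainRep (S ∖ a) → ChainRep S
  reinsert-twin (inj₂ _) (inj₁ x₀) (inj₁ x₁) a∈S b∈S _ _ a≢b ab ba R =
    TwinX.extended a∈S b∈S (a≢b ∘ cong inj₁) (λ y y∈S → ab (inj₂ y) y∈S) (λ y y∈S → ba (inj₂ y) y∈S) R
  reinsert-twin {S} (inj₁ _) (inj₂ y₀) (inj₂ y₁) a∈S b∈S _ _ a≢b ab ba R =
    extend-Y R (neighbourChain cs ch sound' complete')
    where
    open NeighbourChain (ChainRep.chain-of R y₁ (∖-intro b∈S (a≢b ∘ sym))) renaming (members to cs; is-chain to ch)
    sound' : ∀ i → i ∈ cs → E i y₀ ≡ true × inj₁ i ∈ˢ S
    sound' i i∈ = let iy₁ , i∈S' = sound i i∈ ; i∈S = proj₁ (∖-elim i∈S') in ba (inj₁ i) i∈S iy₁ , i∈S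
    complete' : ∀ i → E i y₀ ≡ true → inj₁ i ∈ˢ S → i ∈ cs
    complete' i iy₀ i∈S = complete i (ab (inj₁ i) i∈S iy₀) (∖-intro i∈S λ ())
  reinsert-twin (inj₁ _) (inj₁ _) _ _ _ () _ _ _ _ _
  reinsert-twin (inj₂ _) (inj₂ _) _ _ _ () _ _ _ _ _
  reinsert-twin (inj₁ _) (inj₂ _) (inj₁ _) _ _ _ () _ _ _
  reinsert-twin (inj₂ _) (inj₁ _) (inj₂ _) _ _ _ () _ _ _

  two-or-fewer : ∀ S → (Σ V λ p → Σ V λ q → p ∈ˢ S × q ∈ˢ S × p ≢ q) ⊎
                       (∀ v w → v ∈ˢ S → w ∈ˢ S → v ≡ w)
  two-or-fewer S with anyV (λ p → anyV (λ q → p ∈ˢ? S ×-dec q ∈ˢ? S ×-dec ¬? (p ≟V q)))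
  ... | yes two = inj₁ two
  ... | no ¬two = inj₂ λ v w v∈S w∈S → case (v ≟V w) v∈S w∈S
    where
    case : ∀ {v w} → Dec (v ≡ w) → v ∈ˢ S → w ∈ˢ S → v ≡ w
    case (yes e) _ _ = e
    case {v} {w} (no v≢w) v∈S w∈S = ⊥-elim (¬two (v , w , v∈S , w∈S , v≢w))

  represent : ∀ fuel S → size S < fuel → ConnectedOn G S → ChainRep S
  represent (suc fuel) S small conn with two-or-fewer S
  ... | inj₂ at-most-one = trivial-rep S at-most-one
  ... | inj₁ (p , q , p∈S , q∈S , p≢q) with FarthestVertex.reduction S conn p∈S q∈S p≢q
  ...   | pendant u w u∈S w∈S uw only =
    reinsert-pendant u w u∈S w∈S uw only
      (represent fuel (S ∖ u) (<-≤-trans (size-∖ u∈S) (s≤s⁻¹ small)) (connected-∖ conn bypass))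
    where
    -- u has only one neighbour, so there is nothing to bypass
    bypass : ∀ w₁ w₂ → w₁ ∈ˢ S → w₂ ∈ˢ S → Adj G w₁ u → Adj G u w₂ → ∃ λ k → Walk G (S ∖ u) w₁ w₂ k
    bypass w₁ w₂ w₁∈S w₂∈S w₁u uw₂ =
      0 , subst (λ z → Walk G (S ∖ u) w₁ z 0) (trans (only w₁ w₁∈S (adj-sym w₁u)) (sym (only w₂ w₂∈S uw₂)))
                (here (∖-intro w₁∈S (λ e → adj-irrefl (subst (λ z → Adj G z u) e w₁u))))
  ...   | twins u a b a∈S b∈S ua ub a≢b ab ba =
    reinsert-twin u a b a∈S b∈S ua ub a≢b ab ba
      (represent fuel (S ∖ a) (<-≤-trans (size-∖ a∈S) (s≤s⁻¹ small)) (connected-∖ conn bypass))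
    where
    -- neighbours of a are neighbours of its twin b
    bypass : ∀ w₁ w₂ → w₁ ∈ˢ S → w₂ ∈ˢ S → Adj G w₁ a → Adj G a w₂ → ∃ λ k → Walk G (S ∖ a) w₁ w₂ k
    bypass w₁ w₂ w₁∈S w₂∈S w₁a aw₂ =
      2 , step (∖-intro w₁∈S (λ e → adj-irrefl (subst (λ z → Adj G z a) e w₁a))) (adj-sym (ab w₁ w₁∈S (adj-sym w₁a)))
            (step (∖-intro b∈S (a≢b ∘ sym)) (ab w₂ w₂∈S aw₂)
              (here (∖-intro w₂∈S (λ e → adj-irrefl (subst (Adj G a) e aw₂)))))

  representation : Connected G → ChainRep (allV G)
  representation conn = represent (suc (size (allV G))) (allV G) ≤-refl conn

corollary2 : (G : BipGraph) → Connected G → IsBDH G →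
    Σ Digraph λ A → IsArborescence A ×
      Σ (Fin (BipGraph.m G) ⤖ Fin (Digraph.q A)) λ φ →
        ∀ (y : Fin (BipGraph.n G)) →
          ∃ λ u → ∃ λ w → ∃ λ as →
            DPath A u w as × ArcSetIs G A (Bijection.to φ) y as
corollary2 G conn bdh = tree , isArborescence , ⤖-id _ , path-of
  where
  open Representation G
  open ChainRep (Construction.representation G bdh conn)
  open ParentTree par rank rank-par

  arc-set : ∀ {y} (c : NeighbourChain par (allV G) y) → ArcSetIs G tree (λ x → x) y (NeighbourChain.members c)
  arc-set c a = mk⇔ (λ a∈ → a , proj₁ (NeighbourChain.sound c a a∈) , refl)
                    (λ { (x , xy , refl) → NeighbourChain.complete c x xy refl })

  path-of : ∀ y → ∃ λ u → ∃ λ w → ∃ λ as → DPath tree u w as × ArcSetIs G tree (λ x → x) y as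
  path-of y with chain-of y refl
  ... | c@(neighbourChain [] _ _ _)       = zero , zero , [] , dpath nil , arc-set c
  ... | c@(neighbourChain (_ ∷ _) ch _ _) = _ , _ , _ , dpath (proj₂ (chain-walk ch)) , arc-set c
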